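{- Let $k\ge2$, $0\le l\le k$ be integers and let $T$ be a tree of order $n\ge k+1$ with at most $k-l$ leaves. Then $\varepsilon_{k,l}(S;T)=n-1$ for every $l$-subset $S\subseteq V(T)$, and hence $\bar{\varepsilon}_{k,l}(T)=n-1$.
   Context: For a tree $G$ and $S\subseteq V(G)$, $d_G(S)$ is the number of edges of the minimal subtree of $G$ containing $S$. For an $l$-subset $S$ of $V(G)$ ($n=|V(G)|$), $\varepsilon_{k,l}(S;G)=\max\{d_G(S'): S\subseteq S'\subseteq V(G),\ |S'|=k\}$, and $\bar{\varepsilon}_{k,l}(G)=\binom{n}{l}^{ -1}\sum_{|S|=l}\varepsilon_{k,l}(S;G)$. -}

module Defs where

open import Data.Bool using (Bool; true; false; _∧_; if_then_else_)
open import Data.Nat using (ℕ; zero; suc; _+_; _≤_; _<ᵇ_; _≡ᵇ_)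
open import Data.Fin using (Fin; toℕ; fromℕ) renaming (zero to fzero)
open import Data.Fin.Subset using (Subset; _∈_; _⊆_; ∣_∣)
open import Data.Vec using (Vec; []; _∷_; tabulate; lookup)
open import Data.List using (List; []; _∷_; map; _++_; length; allFin; filterᵇ)
open import Data.Nat.ListAction using (sum)
open import Data.Integer using (+_)
open import Data.Rational.Unnormalised using (ℚᵘ; _/_; 0ℚᵘ)
open import Data.Product using (Σ; _×_; _,_)
open import Function.Definitions using (Injective)
open import Relation.Binary.PropositionalEquality using (_≡_)
open import Relation.Nullary using (¬_)

record Graph (n : ℕ) : Set where
  field
    adj   : Fin n → Fin n → Bool
    sym   : ∀ u v → adj u v ≡ adj v u
    irref : ∀ v → adj v v ≡ false
open Graph public

count : {n : ℕ} → (Fin n → Bool) → ℕ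
count p = ∣ tabulate p ∣

mem : {n : ℕ} → Fin n → Subset n → Bool
mem v U = lookup U v

degree : {n : ℕ} → Graph n → Fin n → ℕ
degree G v = count (adj G v)

numLeaves : {n : ℕ} → Graph n → ℕ
numLeaves G = count (λ v → degree G v ≡ᵇ 1)

edgesIn : {n : ℕ} → Graph n → Subset n → ℕ
edgesIn {n} G U =
  sum (map (λ i → count (λ j → (toℕ i <ᵇ toℕ j) ∧ adj G i j ∧ mem i U ∧ mem j U))
                     (allFin n))

-- walks staying inside U (the start vertex's membership is handled separately)
data WalkIn {n : ℕ} (G : Graph n) (U : Subset n) : Fin n → Fin n → Set where
  here : ∀ {u} → WalkIn G U u u
  step : ∀ {u w v} → adj G u w ≡ true → w ∈ U → WalkIn G U w v → WalkIn G U u v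

-- the subgraph induced on U is connected (the empty subgraph counts as connected)
ConnectedIn : {n : ℕ} → Graph n → Subset n → Set
ConnectedIn G U = ∀ u v → u ∈ U → v ∈ U → WalkIn G U u v

Connected : {n : ℕ} → Graph n → Set
Connected {n} G = ConnectedIn G (Data.Fin.Subset.⊤)

record Cycle {n : ℕ} (G : Graph n) : Set where
  field
    m     : ℕ
    c     : Fin (suc (suc (suc m))) → Fin n
    inj   : Injective _≡_ _≡_ c
    cons  : ∀ i j → toℕ j ≡ suc (toℕ i) → adj G (c i) (c j) ≡ true
    close : adj G (c (fromℕ (suc (suc m)))) (c fzero) ≡ true

Acyclic : {n : ℕ} → Graph n → Set
Acyclic G = ¬ Cycle G

IsTree : {n : ℕ} → Graph n → Set
IsTree G = Connected G × Acyclic G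

IsMinSubtree : {n : ℕ} → Graph n → Subset n → Subset n → Set
IsMinSubtree G S U =
  S ⊆ U × ConnectedIn G U × (∀ U' → S ⊆ U' → ConnectedIn G U' → U ⊆ U')

SteinerDist : {n : ℕ} → Graph n → Subset n → ℕ → Set
SteinerDist G S d = Σ _ λ U → IsMinSubtree G S U × edgesIn G U ≡ d

IsEcc : {n : ℕ} → Graph n → ℕ → Subset n → ℕ → Set
IsEcc G k S e =
  (Σ _ λ S' → S ⊆ S' × ∣ S' ∣ ≡ k × SteinerDist G S' e)
  × (∀ S' d → S ⊆ S' → ∣ S' ∣ ≡ k → SteinerDist G S' d → d ≤ e)

allSubsets : (n : ℕ) → List (Subset n)
allSubsets zero = [] ∷ []
allSubsets (suc n) = map (true ∷_) (allSubsets n) ++ map (false ∷_) (allSubsets n)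

lSubsets : (n l : ℕ) → List (Subset n)
lSubsets n l = filterᵇ (λ S → ∣ S ∣ ≡ᵇ l) (allSubsets n)

-- arithmetic mean of a list of naturals (0 for the empty list)
mean : List ℕ → ℚᵘ
mean [] = 0ℚᵘ
mean (x ∷ xs) = (+ sum (x ∷ xs)) / length (x ∷ xs)

-- A tree on n vertices has n − 1 edges: the far end of a maximal path is a leaf, and deleting it
-- leaves a smaller tree. A connected vertex set U containing every leaf of a tree is the whole
-- tree: a vertex v ∉ U has two neighbours (else it is a leaf), walking away from v through each
-- reaches two leaves, and these are joined inside U, which avoids v, closing a cycle through v.
-- So if T has at most k − l leaves, every l-set S extends to a k-set containing all leaves,
-- whose Steiner tree is T with n − 1 edges, the largest possible; hence ε(S) = n − 1 for all S.

module Submission where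

open import Defs hiding (sym)
open import Data.Bool using (Bool; true; T; T?; _∧_)
open import Data.Bool.Properties using (T-≡; T-∧) renaming (_≟_ to _≟ᵇ_)
open import Data.Empty using (⊥-elim)
open import Data.Fin as Fin using (Fin; toℕ; fromℕ; fromℕ<) renaming (zero to fzero; suc to fsuc)
open import Data.Fin.Properties using (<-cmp; any?; pigeonhole) renaming (_≟_ to _≟ᶠ_)
import Data.Fin.Properties as Finₚ
open import Data.Fin.Subset using (Subset; _∈_; _∉_; _⊆_; _⊂_; _∪_; _-_; ⊤; ⊥; ⁅_⁆; ∣_∣; inside; outside)
open import Data.Fin.Subset.Properties
  using (∈⊤; ⊆⊤; _∈?_; x∈⁅x⁆; x∈⁅y⁆⇒x≡y; ∣⁅x⁆∣≡1; ∣⊤∣≡n; ∣⊥∣≡0; ⊆-antisym; p⊆q⇒∣p∣≤∣q∣;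
         p⊆p∪q; q⊆p∪q; p─q⊆p; p─⊥≡p; x∈p∧x≢y⇒x∈p-y; x∈p⇒p-x⊂p; Empty-unique)
open import Data.Fin.Subset.Induction using (⊂-wellFounded; Acc; acc)
open import Data.Integer as ℤ using (+_)
open import Data.Integer.Properties using (pos-*)
import Data.Integer.Properties as ℤₚ
open import Data.List as List using (List; []; _∷_; length; map; tabulate)
open import Data.List.Properties using (map-tabulate; tabulate-cong)
open import Data.List.Membership.Propositional using () renaming (_∈_ to _∈ₗ_; _∉_ to _∉ₗ_)
open import Data.List.Membership.Propositional.Properties
  using (∈-++⁺ˡ; ∈-++⁺ʳ; ∈-map⁺; ∈-filter⁺; ∈-filter⁻; ∈-lookup)
open import Data.List.Relation.Binary.Subset.Propositional using () renaming (_⊆_ to _⊆ₗ_)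
open import Data.List.Relation.Unary.Any using (here; there)
open import Data.List.Relation.Unary.All as All using (All; [])
open import Data.List.Relation.Unary.All.Properties using (¬Any⇒All¬)
open import Data.List.Relation.Unary.Linked using (Linked; [-]; _∷_)
open import Data.List.Relation.Unary.Unique.Propositional using (Unique; []; _∷_)
open import Data.Nat using (ℕ; zero; suc; _+_; _*_; _∸_; _≤_; z≤n; s≤s; _≤?_; _<ᵇ_; _≡ᵇ_)
open import Data.Nat.Properties
  using (≤-reflexive; ≤-trans; module ≤-Reasoning; ≤-antisym; ≰⇒>; +-mono-≤; +-monoʳ-≤; +-suc; *-comm; m≤n+m; n≤1+n;
         1+n≰n; +-identityʳ; m+[n∸m]≡n; suc-injective; <ᵇ⇒<; <⇒<ᵇ; ≡ᵇ⇒≡; ≡⇒≡ᵇ)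
open import Data.Nat.ListAction using (sum)
open import Data.Product using (Σ; ∃; ∃₂; _×_; _,_; proj₁; proj₂)
open import Data.Product.Function.NonDependent.Propositional using (_×-⇔_)
open import Data.Rational.Unnormalised using (_/_; _≃_; *≡*)
open import Data.Sum using (_⊎_; inj₁; inj₂; [_,_])
open import Data.Vec using (_∷_; []; lookup; here; there) renaming (tabulate to tabulateᵛ)
open import Data.Vec.Properties using ([]=⇒lookup; lookup⇒[]=; lookup∘tabulate)
open import Function using (_∘_; id)
open import Function.Bundles using (_⇔_; mk⇔; Equivalence)
open import Function.Properties.Equivalence using () renaming (trans to ⇔-trans; sym to sym⇔; refl to ⇔-refl)
open import Relation.Binary.Definitions using (tri<; tri≈; tri>)
open import Relation.Binary.PropositionalEquality
  using (_≡_; _≢_; refl; sym; trans; cong; cong₂; subst; subst₂; module ≡-Reasoning)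
open import Relation.Nullary using (¬_; Dec; yes; no; ¬?)
open import Relation.Nullary.Decidable using (_×-dec_; decidable-stable)

open Equivalence using (to; from)

private
  variable
    n : ℕ

sum-tabulate-mono : {h h′ : Fin n → ℕ} → (∀ i → h i ≤ h′ i) → sum (tabulate h) ≤ sum (tabulate h′)
sum-tabulate-mono {zero}  _    = z≤n
sum-tabulate-mono {suc n} h≤h′ = +-mono-≤ (h≤h′ fzero) (sum-tabulate-mono (h≤h′ ∘ fsuc))

sum-tabulate-zero : {h : Fin n → ℕ} → (∀ i → h i ≡ 0) → sum (tabulate h) ≡ 0
sum-tabulate-zero {zero}  _    = refl
sum-tabulate-zero {suc n} h≡0 = cong₂ _+_ (h≡0 fzero) (sum-tabulate-zero (h≡0 ∘ fsuc))

sum-tabulate-punch : (h h′ : Fin n → ℕ) (a : Fin n) → h a ≡ suc (h′ a) → (∀ i → i ≢ a → h i ≡ h′ i)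
                   → sum (tabulate h) ≡ suc (sum (tabulate h′))
sum-tabulate-punch {suc n} h h′ fzero    ha others =
  cong₂ _+_ ha (cong sum (tabulate-cong (λ i → others (fsuc i) λ ())))
sum-tabulate-punch {suc n} h h′ (fsuc a) ha others =
  trans (cong₂ _+_ (others fzero λ ())
                   (sum-tabulate-punch (h ∘ fsuc) (h′ ∘ fsuc) a ha
                                       (λ i i≢a → others (fsuc i) (i≢a ∘ Finₚ.suc-injective))))
        (+-suc (h′ fzero) _)

-- Subsets

∈⇔T-lookup : {p : Subset n} {x : Fin n} → x ∈ p ⇔ T (lookup p x)
∈⇔T-lookup {p = p} {x} = mk⇔ (λ x∈p → from T-≡ ([]=⇒lookup x∈p)) (λ t → lookup⇒[]= x p (to T-≡ t))

∈-tabulate⇔ : {f : Fin n → Bool} {x : Fin n} → x ∈ tabulateᵛ f ⇔ T (f x)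
∈-tabulate⇔ {f = f} {x} = subst (λ b → x ∈ tabulateᵛ f ⇔ T b) (lookup∘tabulate f x) ∈⇔T-lookup

x∉p-x : {p : Subset n} {x : Fin n} → x ∉ p - x
x∉p-x {p = _ ∷ _} {fzero}  ()
x∉p-x {p = _ ∷ _} {fsuc x} (there x∈p-x) = x∉p-x x∈p-x

x∈p-y⇒x≢y : {p : Subset n} {x y : Fin n} → x ∈ p - y → x ≢ y
x∈p-y⇒x≢y x∈p-y refl = x∉p-x x∈p-y

x≢y⇒x∈⊤-y : {x y : Fin n} → x ≢ y → x ∈ ⊤ - y
x≢y⇒x∈⊤-y = x∈p∧x≢y⇒x∈p-y ∈⊤

∣p∣≡1+∣p-x∣ : {p : Subset n} {x : Fin n} → x ∈ p → ∣ p ∣ ≡ suc ∣ p - x ∣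
∣p∣≡1+∣p-x∣ {p = inside  ∷ p} {fzero}  _             = cong (suc ∘ ∣_∣) (sym (p─⊥≡p p))
∣p∣≡1+∣p-x∣ {p = inside  ∷ p} {fsuc x} (there x∈p) = cong suc (∣p∣≡1+∣p-x∣ x∈p)
∣p∣≡1+∣p-x∣ {p = outside ∷ p} {fsuc x} (there x∈p) = ∣p∣≡1+∣p-x∣ x∈p

∣p∪q∣≤∣p∣+∣q∣ : (p q : Subset n) → ∣ p ∪ q ∣ ≤ ∣ p ∣ + ∣ q ∣
∣p∪q∣≤∣p∣+∣q∣ []            []            = z≤n
∣p∪q∣≤∣p∣+∣q∣ (inside  ∷ p) (inside  ∷ q) = s≤s (≤-trans (∣p∪q∣≤∣p∣+∣q∣ p q) (+-monoʳ-≤ ∣ p ∣ (n≤1+n ∣ q ∣)))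
∣p∪q∣≤∣p∣+∣q∣ (inside  ∷ p) (outside ∷ q) = s≤s (∣p∪q∣≤∣p∣+∣q∣ p q)
∣p∪q∣≤∣p∣+∣q∣ (outside ∷ p) (inside  ∷ q) =
  subst (suc ∣ p ∪ q ∣ ≤_) (sym (+-suc ∣ p ∣ ∣ q ∣)) (s≤s (∣p∪q∣≤∣p∣+∣q∣ p q))
∣p∪q∣≤∣p∣+∣q∣ (outside ∷ p) (outside ∷ q) = ∣p∪q∣≤∣p∣+∣q∣ p q

extendTo : ∀ {k} (p : Subset n) → ∣ p ∣ ≤ k → k ≤ n → ∃ λ q → p ⊆ q × ∣ q ∣ ≡ k
extendTo []            z≤n       z≤n       = [] , id , refl
extendTo (inside ∷ p)  (s≤s p≤k) (s≤s k≤n) with extendTo p p≤k k≤n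
... | q , p⊆q , ∣q∣≡k = inside ∷ q , (λ { here → here ; (there x∈p) → there (p⊆q x∈p) }) , cong suc ∣q∣≡k
extendTo {suc n} {k} (outside ∷ p) p≤k k≤1+n with k ≤? n
... | yes k≤n with extendTo p p≤k k≤n
...   | q , p⊆q , ∣q∣≡k = outside ∷ q , (λ { (there x∈p) → there (p⊆q x∈p) }) , ∣q∣≡k
extendTo {suc n} (outside ∷ p) p≤k k≤1+n | no k≰n =
  ⊤ , ⊆⊤ , trans (∣⊤∣≡n (suc n)) (≤-antisym (≰⇒> k≰n) k≤1+n)

sum-∣∣-remove : ∀ {m} (R R′ : Fin n → Subset m) (a : Fin n) (b : Fin m) → b ∈ R a
              → (∀ i j → j ∈ R′ i ⇔ (j ∈ R i × ¬ (i ≡ a × j ≡ b)))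
              → sum (tabulate (∣_∣ ∘ R)) ≡ suc (sum (tabulate (∣_∣ ∘ R′)))
sum-∣∣-remove R R′ a b b∈Ra R′⇔ = sum-tabulate-punch (∣_∣ ∘ R) (∣_∣ ∘ R′) a row-a other-row
  where
  other-row : ∀ i → i ≢ a → ∣ R i ∣ ≡ ∣ R′ i ∣
  other-row i i≢a = cong ∣_∣ (⊆-antisym (λ j∈ → from (R′⇔ i _) (j∈ , i≢a ∘ proj₁)) (proj₁ ∘ to (R′⇔ i _)))
  R′a≡Ra-b : R′ a ≡ R a - b
  R′a≡Ra-b = ⊆-antisym
    (λ {j} j∈ → let j∈Ra , ¬ab = to (R′⇔ a j) j∈ in x∈p∧x≢y⇒x∈p-y j∈Ra (λ j≡b → ¬ab (refl , j≡b)))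
    (λ j∈ → from (R′⇔ a _) (p─q⊆p _ _ j∈ , x∈p-y⇒x≢y j∈ ∘ proj₂))
  row-a : ∣ R a ∣ ≡ suc ∣ R′ a ∣
  row-a = trans (∣p∣≡1+∣p-x∣ b∈Ra) (cong (suc ∘ ∣_∣) (sym R′a≡Ra-b))

Linked-lookup : {A : Set} {R : A → A → Set} {xs : List A} → Linked R xs
              → (i j : Fin (length xs)) → toℕ j ≡ suc (toℕ i) → R (List.lookup xs i) (List.lookup xs j)
Linked-lookup (r ∷ _)  fzero    (fsuc fzero) _  = r
Linked-lookup (_ ∷ rs) (fsuc i) (fsuc j)     eq = Linked-lookup rs i j (suc-injective eq)

Unique-lookup-injective : {A : Set} {xs : List A} → Unique xs
                        → (i j : Fin (length xs)) → List.lookup xs i ≡ List.lookup xs j → i ≡ j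
Unique-lookup-injective (_ ∷ _)      fzero    fzero    _  = refl
Unique-lookup-injective (x∉xs ∷ _)   fzero    (fsuc j) eq = ⊥-elim (All.lookup x∉xs (∈-lookup j) eq)
Unique-lookup-injective (x∉xs ∷ _)   (fsuc i) fzero    eq = ⊥-elim (All.lookup x∉xs (∈-lookup i) (sym eq))
Unique-lookup-injective (_ ∷ unique) (fsuc i) (fsuc j) eq = cong fsuc (Unique-lookup-injective unique i j eq)

Unique⇒length≤ : (xs : List (Fin n)) → Unique xs → length xs ≤ n
Unique⇒length≤ {n} xs unique with length xs ≤? n
... | yes len≤n = len≤n
... | no len≰n with pigeonhole (≰⇒> len≰n) (List.lookup xs)
...   | i , j , i<j , eq = ⊥-elim (Finₚ.<⇒≢ i<j (Unique-lookup-injective unique i j eq))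

another : 2 ≤ n → (v : Fin n) → ∃ (_≢ v)
another (s≤s (s≤s _)) fzero    = fsuc fzero , λ ()
another (s≤s (s≤s _)) (fsuc _) = fzero , λ ()

SamePair : {A : Set} → A → A → A → A → Set
SamePair i j a b = (i ≡ a × j ≡ b) ⊎ (i ≡ b × j ≡ a)

SamePair-trans : {A : Set} {i j x p a b : A} → SamePair i j x p → SamePair a b x p → SamePair i j a b
SamePair-trans (inj₁ (refl , refl)) (inj₁ (refl , refl)) = inj₁ (refl , refl)
SamePair-trans (inj₁ (refl , refl)) (inj₂ (refl , refl)) = inj₂ (refl , refl)
SamePair-trans (inj₂ (refl , refl)) (inj₁ (refl , refl)) = inj₂ (refl , refl)
SamePair-trans (inj₂ (refl , refl)) (inj₂ (refl , refl)) = inj₁ (refl , refl)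

SamePair-ordered : {i j a b : Fin n} → i Fin.< j → a Fin.< b → SamePair i j a b → i ≡ a × j ≡ b
SamePair-ordered _   _   (inj₁ eq)            = eq
SamePair-ordered i<j a<b (inj₂ (refl , refl)) = ⊥-elim (Finₚ.<-asym i<j a<b)

module _ (G : Graph n) where

  open import Data.List.Membership.DecPropositional (_≟ᶠ_ {n}) using () renaming (_∈?_ to _∈ₗ?_)

  Adj : Fin n → Fin n → Set
  Adj u v = adj G u v ≡ true

  Adj-sym : ∀ {u v} → Adj u v → Adj v u
  Adj-sym {u} {v} uv = trans (Graph.sym G v u) uv

  Adj-irrefl : ∀ {u} → ¬ Adj u u
  Adj-irrefl {u} uu with trans (sym uu) (irref G u)
  ... | ()

  Adj⇒≢ : ∀ {u v} → Adj u v → u ≢ v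
  Adj⇒≢ uv refl = Adj-irrefl uv

  ∈neighbours⇔ : ∀ {v w} → w ∈ tabulateᵛ (adj G v) ⇔ Adj v w
  ∈neighbours⇔ = ⇔-trans ∈-tabulate⇔ T-≡

  degree≡1 : ∀ {v a} → Adj v a → (∀ {w} → Adj v w → w ≡ a) → degree G v ≡ 1
  degree≡1 {v} {a} va only = trans (cong ∣_∣ neighbours≡⁅a⁆) (∣⁅x⁆∣≡1 a)
    where
    neighbours≡⁅a⁆ : tabulateᵛ (adj G v) ≡ ⁅ a ⁆
    neighbours≡⁅a⁆ = ⊆-antisym
      (λ w∈ → subst (_∈ ⁅ a ⁆) (sym (only (to ∈neighbours⇔ w∈))) (x∈⁅x⁆ a))
      (λ w∈ → subst (_∈ tabulateᵛ (adj G v)) (sym (x∈⁅y⁆⇒x≡y a w∈)) (from ∈neighbours⇔ va))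

  -- Walks and cycles

  vertices : ∀ {U u v} → WalkIn G U u v → List (Fin n)
  later : ∀ {U u v} → WalkIn G U u v → List (Fin n)
  vertices {u = u} W = u ∷ later W
  later here         = []
  later (step _ _ W) = vertices W

  end∈vertices : ∀ {U u v} (W : WalkIn G U u v) → v ∈ₗ vertices W
  end∈vertices here         = here refl
  end∈vertices (step _ _ W) = there (end∈vertices W)

  vertices⊆ : ∀ {U u v} → u ∈ U → (W : WalkIn G U u v) → ∀ {w} → w ∈ₗ vertices W → w ∈ U
  vertices⊆ uU _            (here refl) = uU
  vertices⊆ _  (step _ wU W) (there w∈) = vertices⊆ wU W w∈

  Linked-vertices : ∀ {U u v} (W : WalkIn G U u v) → Linked Adj (vertices W)
  Linked-vertices here                  = [-]
  Linked-vertices (step uw _ here)      = uw ∷ [-]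
  Linked-vertices (step uw _ W@(step _ _ _)) = uw ∷ Linked-vertices W

  lookup-last : ∀ {U u v} (x : Fin n) (W : WalkIn G U u v)
              → List.lookup (x ∷ vertices W) (fromℕ (length (vertices W))) ≡ v
  lookup-last _ here                    = refl
  lookup-last _ (step {u = u} _ _ W) = lookup-last u W

  weaken : ∀ {U V a b} → U ⊆ V → WalkIn G U a b → WalkIn G V a b
  weaken U⊆V here          = here
  weaken U⊆V (step e wU W) = step e (U⊆V wU) (weaken U⊆V W)

  _++ᵂ_ : ∀ {V a b c} → WalkIn G V a b → WalkIn G V b c → WalkIn G V a c
  here          ++ᵂ W′ = W′
  step e wV W   ++ᵂ W′ = step e wV (W ++ᵂ W′)

  reverse : ∀ {V a b} → a ∈ V → WalkIn G V a b → WalkIn G V b a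
  reverse aV here          = here
  reverse aV (step e wV W) = reverse wV W ++ᵂ step (Adj-sym e) aV here

  prefix : ∀ {U a b w} (W : WalkIn G U a b) → w ∈ₗ vertices W
         → Σ (WalkIn G U a w) λ P → vertices P ⊆ₗ vertices W
  prefix W             (here refl) = here , λ { (here refl) → here refl }
  prefix (step e wU W) (there w∈) with prefix W w∈
  ... | P , P⊆W = step e wU P , λ { (here refl) → here refl ; (there z∈) → there (P⊆W z∈) }

  PathAmong : Subset n → Fin n → Fin n → List (Fin n) → Set
  PathAmong U a b xs = Σ (WalkIn G U a b) λ P → Unique (vertices P) × vertices P ⊆ₗ xs

  suffix : ∀ {U w a b} (P : WalkIn G U w b) → Unique (vertices P) → a ∈ₗ vertices P
         → PathAmong U a b (vertices P)
  suffix P             unique       (here refl) = P , unique , id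
  suffix (step _ _ P)  (_ ∷ unique) (there a∈P) with suffix P unique a∈P
  ... | Q , uQ , Q⊆P = Q , uQ , there ∘ Q⊆P

  shortcut : ∀ {U a b} (W : WalkIn G U a b) → PathAmong U a b (vertices W)
  shortcut here = here , [] ∷ [] , id
  shortcut {a = a} (step e wU W) with shortcut W
  ... | P , uP , P⊆W with a ∈ₗ? vertices P
  ...   | yes a∈P = let Q , uQ , Q⊆P = suffix P uP a∈P in Q , uQ , there ∘ P⊆W ∘ Q⊆P
  ...   | no  a∉P =
    step e wU P , ¬Any⇒All¬ _ a∉P ∷ uP , λ { (here refl) → here refl ; (there z∈) → there (P⊆W z∈) }

  cycleOfList : ∀ x y z zs → Unique (x ∷ y ∷ z ∷ zs) → Linked Adj (x ∷ y ∷ z ∷ zs)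
              → Adj (List.lookup (x ∷ y ∷ z ∷ zs) (fromℕ (2 + length zs))) x → Cycle G
  cycleOfList x y z zs unique linked closing = record
    { m     = length zs
    ; c     = List.lookup (x ∷ y ∷ z ∷ zs)
    ; inj   = λ {i} {j} → Unique-lookup-injective unique i j
    ; cons  = Linked-lookup linked
    ; close = closing
    }

  cycleThrough : ∀ {U a b v} (W : WalkIn G U a b) → v ∉ₗ vertices W → Adj v a → Adj b v → a ≢ b → Cycle G
  cycleThrough {v = v} W v∉W va bv a≢b with shortcut W
  ... | here          , _  , _    = ⊥-elim (a≢b refl)
  ... | P@(step _ _ _) , uP , P⊆W =
    cycleOfList v _ _ _ (¬Any⇒All¬ _ (v∉W ∘ P⊆W) ∷ uP) (va ∷ Linked-vertices P)
                (subst (λ t → Adj t v) (sym (lookup-last v P)) bv)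

  record MaximalPath (U : Subset n) (z : Fin n) : Set where
    constructor maximalPath
    field
      {start}   : Fin n
      start∈U   : start ∈ U
      walk      : WalkIn G U start z
      unique    : Unique (vertices walk)
      saturated : ∀ {w} → w ∈ U → Adj start w → w ∈ₗ vertices walk

  private
    newNeighbour? : ∀ U x vs → Dec (∃ λ w → w ∈ U × Adj x w × w ∉ₗ vs)
    newNeighbour? U x vs = any? (λ w → (w ∈? U) ×-dec ((adj G x w ≟ᵇ true) ×-dec ¬? (w ∈ₗ? vs)))

    extend : ∀ {U x z} (fuel : ℕ) (W : WalkIn G U x z) → x ∈ U → Unique (vertices W)
           → n ≤ length (vertices W) + fuel → MaximalPath U z
    extend {U} {x} fuel W xU unique bound with newNeighbour? U x (vertices W)
    ... | no none = maximalPath xU W unique saturated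
      where
      saturated : ∀ {w} → w ∈ U → Adj x w → w ∈ₗ vertices W
      saturated {w} wU xw = decidable-stable (w ∈ₗ? vertices W) λ w∉W → none (w , wU , xw , w∉W)
    ... | yes (w , wU , xw , w∉W) with fuel
    ...   | zero     = ⊥-elim (1+n≰n (≤-trans (Unique⇒length≤ (w ∷ vertices W) (¬Any⇒All¬ _ w∉W ∷ unique))
                                               (subst (n ≤_) (+-identityʳ _) bound)))
    ...   | suc fuel = extend fuel (step (Adj-sym xw) xU W) wU (¬Any⇒All¬ _ w∉W ∷ unique)
                              (subst (n ≤_) (+-suc _ fuel) bound)

  maximalPathTo : ∀ {U z} → z ∈ U → MaximalPath U z
  maximalPathTo zU = extend n here zU ([] ∷ []) (m≤n+m n 1)

  saturated-here⇒isolated : ∀ {U x} → (∀ {w} → w ∈ U → Adj x w → w ∈ₗ x ∷ []) → ∀ {w} → w ∈ U → ¬ Adj x w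
  saturated-here⇒isolated saturated wU xw with saturated wU xw
  ... | here refl = Adj-irrefl xw

  -- Counting edges

  Edge : Subset n → Fin n → Fin n → Set
  Edge U i j = i Fin.< j × Adj i j × i ∈ U × j ∈ U

  edgeRow : Subset n → Fin n → Subset n
  edgeRow U i = tabulateᵛ (λ j → (toℕ i <ᵇ toℕ j) ∧ adj G i j ∧ mem i U ∧ mem j U)

  ∈edgeRow⇔ : ∀ U {i j} → j ∈ edgeRow U i ⇔ Edge U i j
  ∈edgeRow⇔ _ =
    ⇔-trans ∈-tabulate⇔ (⇔-trans T-∧ (<ᵇ⇔< ×-⇔ ⇔-trans T-∧ (T-≡ ×-⇔ ⇔-trans T-∧ (∈⇔ᵇ ×-⇔ ∈⇔ᵇ))))
    where
    <ᵇ⇔< : ∀ {i j : Fin n} → T (toℕ i <ᵇ toℕ j) ⇔ i Fin.< j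
    <ᵇ⇔< = mk⇔ (<ᵇ⇒< _ _) <⇒<ᵇ
    ∈⇔ᵇ : ∀ {U i} → T (mem i U) ⇔ i ∈ U
    ∈⇔ᵇ = sym⇔ ∈⇔T-lookup

  edgesIn≡ : ∀ U → edgesIn G U ≡ sum (tabulate (∣_∣ ∘ edgeRow U))
  edgesIn≡ U = cong sum (map-tabulate {n = n} id (∣_∣ ∘ edgeRow U))

  edgesIn-mono : ∀ {U V} → U ⊆ V → edgesIn G U ≤ edgesIn G V
  edgesIn-mono {U} {V} U⊆V = subst₂ _≤_ (sym (edgesIn≡ U)) (sym (edgesIn≡ V))
    (sum-tabulate-mono λ i → p⊆q⇒∣p∣≤∣q∣ (rowU⊆rowV i))
    where
    rowU⊆rowV : ∀ i → edgeRow U i ⊆ edgeRow V i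
    rowU⊆rowV i j∈ with to (∈edgeRow⇔ U) j∈
    ... | i<j , ij , iU , jU = from (∈edgeRow⇔ V) (i<j , ij , U⊆V iU , U⊆V jU)

  edgesIn-⁅⁆ : ∀ x → edgesIn G ⁅ x ⁆ ≡ 0
  edgesIn-⁅⁆ x =
    trans (edgesIn≡ ⁅ x ⁆) (sum-tabulate-zero λ i → trans (cong ∣_∣ (Empty-unique (noEdge i))) (∣⊥∣≡0 n))
    where
    noEdge : ∀ i → ¬ ∃ (_∈ edgeRow ⁅ x ⁆ i)
    noEdge i (j , j∈) with to (∈edgeRow⇔ ⁅ x ⁆) j∈
    ... | i<j , _ , i∈ , j∈⁅x⁆ = Finₚ.<-irrefl (trans (x∈⁅y⁆⇒x≡y x i∈) (sym (x∈⁅y⁆⇒x≡y x j∈⁅x⁆))) i<j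

  OnlyNeighbourIn : Subset n → Fin n → Fin n → Set
  OnlyNeighbourIn U x p = ∀ {w} → w ∈ U → Adj x w → w ≡ p

  edge-endpoints : ∀ {U x p} → x ∈ U → p ∈ U → Adj x p → ∃₂ λ a b → Edge U a b × SamePair a b x p
  edge-endpoints {x = x} {p} xU pU xp with <-cmp x p
  ... | tri< x<p _ _ = x , p , (x<p , xp , xU , pU) , inj₁ (refl , refl)
  ... | tri≈ _ x≡p _ = ⊥-elim (Adj⇒≢ xp x≡p)
  ... | tri> _ _ p<x = p , x , (p<x , Adj-sym xp , pU , xU) , inj₂ (refl , refl)

  Edge-touching : ∀ {U x p i j} → OnlyNeighbourIn U x p → Edge U i j → i ≡ x ⊎ j ≡ x → SamePair i j x p
  Edge-touching only (_ , ij , _  , jU) (inj₁ refl) = inj₁ (refl , only jU ij)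
  Edge-touching only (_ , ij , iU , _)  (inj₂ refl) = inj₂ (only iU (Adj-sym ij) , refl)

  Edge-minus-leaf⇔ : ∀ {U x p a b} → OnlyNeighbourIn U x p → Edge U a b → SamePair a b x p
                   → ∀ i j → Edge (U - x) i j ⇔ (Edge U i j × ¬ (i ≡ a × j ≡ b))
  Edge-minus-leaf⇔ {U} {x} {p} {a} {b} only eab ab≡xp i j = mk⇔ forth back
    where
    forth : Edge (U - x) i j → Edge U i j × ¬ (i ≡ a × j ≡ b)
    forth (i<j , ij , iU′ , jU′) =
      (i<j , ij , p─q⊆p _ _ iU′ , p─q⊆p _ _ jU′) ,
      λ { (refl , refl) → [ (λ (a≡x , _) → x∈p-y⇒x≢y iU′ a≡x) , (λ (_ , b≡x) → x∈p-y⇒x≢y jU′ b≡x) ] ab≡xp }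
    back : Edge U i j × ¬ (i ≡ a × j ≡ b) → Edge (U - x) i j
    back (eij@(i<j , ij , iU , jU) , ¬ab) =
      i<j , ij , x∈p∧x≢y⇒x∈p-y iU (¬ab ∘ touching ∘ inj₁) , x∈p∧x≢y⇒x∈p-y jU (¬ab ∘ touching ∘ inj₂)
      where
      touching : i ≡ x ⊎ j ≡ x → i ≡ a × j ≡ b
      touching t = SamePair-ordered i<j (proj₁ eab) (SamePair-trans (Edge-touching only eij t) ab≡xp)

  edgesIn-minus-leaf : ∀ {U x p} → x ∈ U → p ∈ U → Adj x p → OnlyNeighbourIn U x p
                     → edgesIn G U ≡ suc (edgesIn G (U - x))
  edgesIn-minus-leaf {U} {x} xU pU xp only with edge-endpoints xU pU xp
  ... | a , b , eab , ab≡xp = begin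
    edgesIn G U                                    ≡⟨ edgesIn≡ U ⟩
    sum (tabulate (∣_∣ ∘ edgeRow U))               ≡⟨ sum-∣∣-remove (edgeRow U) (edgeRow (U - x)) a b
                                                         (from (∈edgeRow⇔ U) eab) rows⇔ ⟩
    suc (sum (tabulate (∣_∣ ∘ edgeRow (U - x))))   ≡⟨ cong suc (edgesIn≡ (U - x)) ⟨
    suc (edgesIn G (U - x))                        ∎
    where
    open ≡-Reasoning
    rows⇔ : ∀ i j → j ∈ edgeRow (U - x) i ⇔ (j ∈ edgeRow U i × ¬ (i ≡ a × j ≡ b))
    rows⇔ i j = ⇔-trans (∈edgeRow⇔ (U - x))
                  (⇔-trans (Edge-minus-leaf⇔ only eab ab≡xp i j) (sym⇔ (∈edgeRow⇔ U) ×-⇔ ⇔-refl))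

  walk-minus-leaf : ∀ {U x p a b} → OnlyNeighbourIn U x p → a ∈ U → a ≢ x → b ≢ x
                  → WalkIn G U a b → WalkIn G (U - x) a b
  walk-minus-leaf only aU a≢x b≢x here = here
  walk-minus-leaf {U} {x} only aU a≢x b≢x (step {w = w} aw wU W) with w ≟ᶠ x
  ... | no w≢x = step aw (x∈p∧x≢y⇒x∈p-y wU w≢x) (walk-minus-leaf only wU w≢x b≢x W)
  walk-minus-leaf only aU a≢x b≢x (step aw wU here)                          | yes refl = ⊥-elim (b≢x refl)
  walk-minus-leaf {U} {x} only aU a≢x b≢x (step aw wU (step xw′ w′U W)) | yes refl =
    -- a and w′ are both the unique neighbour of the leaf x
    subst (λ c → WalkIn G (U - x) c _) (trans (only w′U xw′) (sym (only aU (Adj-sym aw))))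
          (walk-minus-leaf only w′U (Adj⇒≢ xw′ ∘ sym) b≢x W)

  connected-minus-leaf : ∀ {U x p} → ConnectedIn G U → OnlyNeighbourIn U x p → ConnectedIn G (U - x)
  connected-minus-leaf conn only a b aU′ bU′ =
    walk-minus-leaf only (p─q⊆p _ _ aU′) (x∈p-y⇒x≢y aU′) (x∈p-y⇒x≢y bU′)
                    (conn a b (p─q⊆p _ _ aU′) (p─q⊆p _ _ bU′))

  has-neighbour : 2 ≤ n → Connected G → ∀ v → ∃ (Adj v)
  has-neighbour 2≤n conn v with another 2≤n v
  ... | y , y≢v with conn v y ∈⊤ ∈⊤
  ...   | here        = ⊥-elim (y≢v refl)
  ...   | step va _ _ = _ , va

  -- Forests

  module _ (acyclic : Acyclic G) where

    saturated⇒only-neighbour : ∀ {U x p z} → Adj x p → (W : WalkIn G U p z) → Unique (x ∷ vertices W)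
                             → (∀ {w} → w ∈ U → Adj x w → w ∈ₗ x ∷ vertices W) → OnlyNeighbourIn U x p
    saturated⇒only-neighbour {p = p} xp W (x∉W ∷ _) saturated {w} wU xw with saturated wU xw
    ... | here refl  = ⊥-elim (Adj-irrefl xw)
    ... | there w∈W with w ≟ᶠ p
    ...   | yes w≡p = w≡p
    ...   | no  w≢p with prefix W w∈W
    ...     | P , P⊆W = ⊥-elim (acyclic (cycleThrough P (λ x∈P → All.lookup x∉W (P⊆W x∈P) refl)
                                                     xp (Adj-sym xw) (w≢p ∘ sym)))

    isolated⇒singleton : ∀ {U x} → ConnectedIn G U → x ∈ U → (∀ {w} → w ∈ U → ¬ Adj x w) → U ≡ ⁅ x ⁆
    isolated⇒singleton {U} {x} conn xU isolated = ⊆-antisym U⊆⁅x⁆ ⁅x⁆⊆U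
      where
      U⊆⁅x⁆ : U ⊆ ⁅ x ⁆
      U⊆⁅x⁆ {v} vU with conn x v xU vU
      ... | here          = x∈⁅x⁆ x
      ... | step xw wU _  = ⊥-elim (isolated wU xw)
      ⁅x⁆⊆U : ⁅ x ⁆ ⊆ U
      ⁅x⁆⊆U v∈ = subst (_∈ U) (sym (x∈⁅y⁆⇒x≡y x v∈)) xU

    -- The far end of a maximal path in U is a leaf of G[U], and removing it keeps U connected.
    suc-edgesIn≡∣∣ : ∀ {U u} → ConnectedIn G U → u ∈ U → suc (edgesIn G U) ≡ ∣ U ∣
    suc-edgesIn≡∣∣ {U} = go U (⊂-wellFounded U)
      where
      go : ∀ U → Acc _⊂_ U → ∀ {u} → ConnectedIn G U → u ∈ U → suc (edgesIn G U) ≡ ∣ U ∣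
      go U _ conn uU with maximalPathTo uU
      ... | maximalPath {x} xU here _ saturated =
        subst (λ V → suc (edgesIn G V) ≡ ∣ V ∣)
              (sym (isolated⇒singleton conn xU (saturated-here⇒isolated saturated)))
              (trans (cong suc (edgesIn-⁅⁆ x)) (sym (∣⁅x⁆∣≡1 x)))
      go U (acc smaller) conn uU | maximalPath {x} xU (step {w = p} xp pU W) unique saturated = begin
        suc (edgesIn G U)             ≡⟨ cong suc (edgesIn-minus-leaf xU pU xp only) ⟩
        suc (suc (edgesIn G (U - x))) ≡⟨ cong suc (go (U - x) (smaller (x∈p⇒p-x⊂p xU))
                                                       (connected-minus-leaf conn only) pU′) ⟩
        suc ∣ U - x ∣                 ≡⟨ ∣p∣≡1+∣p-x∣ xU ⟨
        ∣ U ∣                         ∎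
        where
        open ≡-Reasoning
        only : OnlyNeighbourIn U x p
        only = saturated⇒only-neighbour xp W unique saturated
        pU′ : p ∈ U - x
        pU′ = x∈p∧x≢y⇒x∈p-y pU (Adj⇒≢ xp ∘ sym)

    leaf-beyond : ∀ {v a} → Adj v a → ∃ λ x → degree G x ≡ 1 × WalkIn G (⊤ - v) a x
    leaf-beyond {v} {a} va = fromMaximal (maximalPathTo (x≢y⇒x∈⊤-y (Adj⇒≢ va ∘ sym)))
      where
      fromMaximal : MaximalPath (⊤ - v) a → ∃ λ x → degree G x ≡ 1 × WalkIn G (⊤ - v) a x
      fromMaximal (maximalPath _ here _ saturated) = a , degree≡1 (Adj-sym va) only-v , here
        where
        only-v : ∀ {w} → Adj a w → w ≡ v
        only-v {w} aw = decidable-stable (w ≟ᶠ v) λ w≢v →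
          saturated-here⇒isolated saturated (x≢y⇒x∈⊤-y w≢v) aw
      fromMaximal (maximalPath {x} xU W@(step {w = p} xp pU W′) unique@(x∉W′ ∷ _) saturated) =
        x , degree≡1 xp only-p , reverse xU W
        where
        only-p : ∀ {w} → Adj x w → w ≡ p
        only-p {w} xw with w ≟ᶠ v
        ... | no  w≢v  = saturated⇒only-neighbour xp W′ unique saturated (x≢y⇒x∈⊤-y w≢v) xw
        ... | yes refl = ⊥-elim (acyclic (cycleThrough W (x∉p-x ∘ vertices⊆ xU W) (Adj-sym xw) (Adj-sym va)
                                                       (All.lookup x∉W′ (end∈vertices W′))))

    -- A vertex outside U with two neighbours closes a cycle through the leaves beyond them.
    internal-vertex∈ : ∀ {U v a b} → ConnectedIn G U → (∀ {x} → degree G x ≡ 1 → x ∈ U)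
                     → Adj v a → Adj v b → a ≢ b → v ∈ U
    internal-vertex∈ {U} {v} {a} {b} connU leaves⊆U va vb a≢b = decidable-stable (v ∈? U) λ v∉U →
      acyclic (cycleThrough (detour v∉U) (x∉p-x ∘ vertices⊆ a∈ (detour v∉U)) va (Adj-sym vb) a≢b)
      where
      a∈ : a ∈ ⊤ - v
      a∈ = x≢y⇒x∈⊤-y (Adj⇒≢ va ∘ sym)
      detour : v ∉ U → WalkIn G (⊤ - v) a b
      detour v∉U with leaf-beyond va | leaf-beyond vb
      ... | xa , da , Pa | xb , db , Pb =
        Pa ++ᵂ (weaken U⊆ (connU xa xb (leaves⊆U da) (leaves⊆U db))
           ++ᵂ reverse (x≢y⇒x∈⊤-y (Adj⇒≢ vb ∘ sym)) Pb)
        where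
        U⊆ : U ⊆ ⊤ - v
        U⊆ wU = x≢y⇒x∈⊤-y λ { refl → v∉U wU }

    leaves-span : 2 ≤ n → Connected G → ∀ {U} → ConnectedIn G U → (∀ {x} → degree G x ≡ 1 → x ∈ U) → ⊤ ⊆ U
    leaves-span 2≤n conn connU leaves⊆U {v} _ with has-neighbour 2≤n conn v
    ... | a , va with any? (λ b → (adj G v b ≟ᵇ true) ×-dec ¬? (b ≟ᶠ a))
    ...   | yes (b , vb , b≢a) = internal-vertex∈ connU leaves⊆U va vb (b≢a ∘ sym)
    ...   | no  none           = leaves⊆U (degree≡1 va only-a)
      where
      only-a : ∀ {w} → Adj v w → w ≡ a
      only-a {w} vw = decidable-stable (w ≟ᶠ a) λ w≢a → none (w , vw , w≢a)

-- Eccentricity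

Leaves : Graph n → Subset n
Leaves G = tabulateᵛ (λ v → degree G v ≡ᵇ 1)

leaf∈Leaves : (G : Graph n) → ∀ {v} → degree G v ≡ 1 → v ∈ Leaves G
leaf∈Leaves G d = from ∈-tabulate⇔ (≡⇒≡ᵇ _ _ d)

edgesIn-⊤ : (G : Graph n) → IsTree G → Fin n → edgesIn G ⊤ ≡ n ∸ 1
edgesIn-⊤ {n} G (conn , acyclic) u = cong (_∸ 1) (trans (suc-edgesIn≡∣∣ G acyclic conn (∈⊤ {x = u})) (∣⊤∣≡n n))

SteinerDist≤edgesIn-⊤ : (G : Graph n) → ∀ {S d} → SteinerDist G S d → d ≤ edgesIn G ⊤
SteinerDist≤edgesIn-⊤ G (U , _ , refl) = edgesIn-mono G {U} ⊆⊤

SteinerDist-⊤ : (G : Graph n) → IsTree G → 2 ≤ n → ∀ {S} → Leaves G ⊆ S → SteinerDist G S (edgesIn G ⊤)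
SteinerDist-⊤ G (conn , acyclic) 2≤n Leaves⊆S =
  ⊤ , (⊆⊤ , conn , λ U S⊆U connU → leaves-span G acyclic 2≤n conn connU (S⊆U ∘ Leaves⊆S ∘ leaf∈Leaves G)) , refl

IsEcc-⊤ : (G : Graph n) → IsTree G → 2 ≤ n → ∀ {k S} → k ≤ n → ∣ S ∪ Leaves G ∣ ≤ k → IsEcc G k S (edgesIn G ⊤)
IsEcc-⊤ G tree 2≤n {S = S} k≤n ∣S∪L∣≤k with extendTo (S ∪ Leaves G) ∣S∪L∣≤k k≤n
... | S′ , S∪L⊆S′ , ∣S′∣≡k =
  (S′ , S∪L⊆S′ ∘ p⊆p∪q _ , ∣S′∣≡k , SteinerDist-⊤ G tree 2≤n (S∪L⊆S′ ∘ q⊆p∪q S _)) ,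
  λ _ _ _ _ → SteinerDist≤edgesIn-⊤ G

IsEcc-unique : {G : Graph n} → ∀ {k S e e′} → IsEcc G k S e → IsEcc G k S e′ → e ≡ e′
IsEcc-unique ((_ , S⊆ , ∣∣≡k , d) , ≤e) ((_ , S⊆′ , ∣∣≡k′ , d′) , ≤e′) =
  ≤-antisym (≤e′ _ _ S⊆ ∣∣≡k d) (≤e _ _ S⊆′ ∣∣≡k′ d′)

∈allSubsets : (p : Subset n) → p ∈ₗ allSubsets n
∈allSubsets []            = here refl
∈allSubsets (inside  ∷ p) = ∈-++⁺ˡ (∈-map⁺ (inside ∷_) (∈allSubsets p))
∈allSubsets (outside ∷ p) = ∈-++⁺ʳ _ (∈-map⁺ (outside ∷_) (∈allSubsets p))

∈lSubsets⇔ : ∀ {l} {p : Subset n} → p ∈ₗ lSubsets n l ⇔ ∣ p ∣ ≡ l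
∈lSubsets⇔ {n} {l} {p} = mk⇔
  (λ p∈ → ≡ᵇ⇒≡ _ _ (proj₂ (∈-filter⁻ size≡l? {xs = allSubsets n} p∈)))
  (λ ∣p∣≡l → ∈-filter⁺ size≡l? (∈allSubsets p) (≡⇒≡ᵇ _ _ ∣p∣≡l))
  where
  size≡l? : (q : Subset n) → Dec (T (∣ q ∣ ≡ᵇ l))
  size≡l? q = T? (∣ q ∣ ≡ᵇ l)

lSubsets-nonempty : ∀ {l} → l ≤ n → ∃ (_∈ₗ lSubsets n l)
lSubsets-nonempty {n} l≤n with extendTo ⊥ (subst (_≤ _) (sym (∣⊥∣≡0 n)) z≤n) l≤n
... | S , _ , ∣S∣≡l = S , from ∈lSubsets⇔ ∣S∣≡l

sum-map-const : {A : Set} (f : A → ℕ) {c : ℕ} (xs : List A) → (∀ {y} → y ∈ₗ xs → f y ≡ c)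
              → sum (map f xs) ≡ length (map f xs) * c
sum-map-const f []       _   = refl
sum-map-const f (y ∷ ys) f≡c = cong₂ _+_ (f≡c (here refl)) (sum-map-const f ys (f≡c ∘ there))

mean-const : {A : Set} (f : A → ℕ) {c : ℕ} {x : A} (xs : List A) → x ∈ₗ xs → (∀ {y} → y ∈ₗ xs → f y ≡ c)
           → mean (map f xs) ≃ (+ c) / 1
mean-const f {c} xs@(_ ∷ _) _ f≡c = *≡* (begin
  + s ℤ.* + 1  ≡⟨ ℤₚ.*-identityʳ (+ s) ⟩
  + s          ≡⟨ cong +_ (trans (sum-map-const f xs f≡c) (*-comm L c)) ⟩
  + (c * L)    ≡⟨ pos-* c L ⟩
  + c ℤ.* + L  ∎)
  where
  open ≡-Reasoning
  s L : ℕ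
  s = sum (map f xs)
  L = length (map f xs)

proposition2 : (k l n : ℕ) → 2 ≤ k → l ≤ k → (T : Graph n) → IsTree T → suc k ≤ n
    → numLeaves T ≤ k ∸ l
    → ((S : Subset n) → ∣ S ∣ ≡ l → IsEcc T k S (n ∸ 1))
      × ((ε : Subset n → ℕ) → ((S : Subset n) → ∣ S ∣ ≡ l → IsEcc T k S (ε S))
         → mean (map ε (lSubsets n l)) ≃ (+ (n ∸ 1)) / 1)
proposition2 k l n 2≤k l≤k T tree k<n leaves≤k∸l = eccentricity , average
  where
  k≤n : k ≤ n
  k≤n = ≤-trans (n≤1+n k) k<n
  eccentricity : (S : Subset n) → ∣ S ∣ ≡ l → IsEcc T k S (n ∸ 1)
  eccentricity S ∣S∣≡l =
    subst (IsEcc T k S) (edgesIn-⊤ T tree (fromℕ< (≤-trans (s≤s z≤n) k<n)))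
          (IsEcc-⊤ T tree (≤-trans 2≤k k≤n) k≤n (begin
            ∣ S ∪ Leaves T ∣      ≤⟨ ∣p∪q∣≤∣p∣+∣q∣ S (Leaves T) ⟩
            ∣ S ∣ + numLeaves T   ≤⟨ +-mono-≤ (≤-reflexive ∣S∣≡l) leaves≤k∸l ⟩
            l + (k ∸ l)           ≡⟨ m+[n∸m]≡n l≤k ⟩
            k                     ∎))
    where open ≤-Reasoning
  average : (ε : Subset n → ℕ) → ((S : Subset n) → ∣ S ∣ ≡ l → IsEcc T k S (ε S))
          → mean (map ε (lSubsets n l)) ≃ (+ (n ∸ 1)) / 1
  average ε isEcc = mean-const ε (lSubsets n l) (proj₂ (lSubsets-nonempty (≤-trans l≤k k≤n)))
    λ S∈ → IsEcc-unique (isEcc _ (to ∈lSubsets⇔ S∈)) (eccentricity _ (to ∈lSubsets⇔ S∈))
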